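{- Let $S_{(4)}$ be the point-line incidence structure $PG(1,2)\times PG(1,2)\times PG(1,2)\times PG(1,2)$: its points are the $81$ quadruples $(a_1,a_2,a_3,a_4)$ with each $a_i$ one of the three points of $PG(1,2)$, and its lines are the $108$ triples of points that agree in three of the four coordinates and take all three values in the remaining coordinate. Then $S_{(4)}$ has exactly $65535 = 2^{16}-1$ geometric hyperplanes. Every geometric hyperplane $H$ satisfies $|\mathcal{L}(H)| = 2|H| - 54$, where $\mathcal{L}(H)$ is the set of lines of $S_{(4)}$ contained in $H$. The possible sizes $|H|$, together with the number of geometric hyperplanes of each size, are: $65$: $81$; $57$: $324$; $53$: $1296$; $51$: $648$; $49$: $648$; $47$: $3888$; $45$: $6732$; $43$: $7776$; $41$: $9234$; $39$: $14472$; $37$: $12636$; $35$: $5184$; $33$: $1944$; $31$: $648$; $27$: $24$. In particular, $S_{(4)}$ has exactly $24$ ovoids (sets of $27$ pairwise non-collinear points meeting every line).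
   Context: A geometric hyperplane of a point-line incidence structure is a proper subset $H$ of its point set such that every line is either entirely contained in $H$ or meets $H$ in exactly one point. (The whole point set is not counted as a geometric hyperplane here.) -}

module Defs where

open import Data.Nat using (ℕ; _+_; _*_; _≡ᵇ_)
open import Data.Bool using (if_then_else_)
open import Data.Fin using (Fin; combine)
open import Data.Fin.Subset using (Subset; _∈_; ⊤; ∣_∣)
open import Data.Vec using (Vec; insertAt)
import Data.Vec
open Data.Vec using () renaming ([] to []ᵥ; _∷_ to _∷ᵥ_)
open import Data.List using (List; length; []; _∷_)
open import Data.List.Relation.Unary.Unique.Propositional using (Unique)
import Data.List.Membership.Propositional as LM
open import Data.Product using (_,_; Σ; ∃; ∃-syntax; _×_)
open import Data.Sum using (_⊎_)
open import Relation.Nullary using (¬_)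
open import Relation.Binary.PropositionalEquality using (_≡_; _≢_)
open import Function.Bundles using (_⇔_)

-- "P holds for exactly n elements of A": a duplicate-free list whose members
-- are exactly the elements satisfying P, of length n.
HasCount : {A : Set} → (A → Set) → ℕ → Set
HasCount {A} P n =
  Σ (List A) λ L → Unique L × (∀ x → (LM._∈_ x L) ⇔ P x) × length L ≡ n

-- PG(1,2) has three points, modelled as Fin 3.
-- Points of S(4) = PG(1,2)^4.
Point : Set
Point = Vec (Fin 3) 4

-- Encoding of the 81 points into Fin 81 (a bijection), so that point sets
-- are subsets of Fin 81.
idx : Point → Fin 81
idx (a ∷ᵥ b ∷ᵥ c ∷ᵥ d ∷ᵥ []ᵥ) = combine a (combine b (combine c d))

PointSet : Set
PointSet = Subset 81

_∈ₚ_ : Point → PointSet → Set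
p ∈ₚ H = idx p ∈ H

-- A line: a coordinate position i (the varying coordinate) and the values
-- of the three remaining coordinates. There are 4 * 27 = 108 lines, each
-- given exactly once.
Line : Set
Line = Fin 4 × Vec (Fin 3) 3

pt : Line → Fin 3 → Point
pt (i , v) x = insertAt v i x

LineIn : PointSet → Line → Set
LineIn H l = ∀ x → pt l x ∈ₚ H

MeetsOnce : PointSet → Line → Set
MeetsOnce H l = ∃[ x ] (pt l x ∈ₚ H × (∀ y → pt l y ∈ₚ H → y ≡ x))

IsGeomHyperplane : PointSet → Set
IsGeomHyperplane H = H ≢ ⊤ × (∀ l → LineIn H l ⊎ MeetsOnce H l)

Collinear : Point → Point → Set
Collinear p q = p ≢ q × ∃[ l ] ∃[ x ] ∃[ y ] (pt l x ≡ p × pt l y ≡ q)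

IsOvoid : PointSet → Set
IsOvoid H = ∣ H ∣ ≡ 27
          × (∀ p q → p ∈ₚ H → q ∈ₚ H → ¬ Collinear p q)
          × (∀ l → ∃[ x ] (pt l x ∈ₚ H))

-- Number of geometric hyperplanes of each size (0 for other sizes).
sizeTable : List (ℕ × ℕ)
sizeTable =
  (65 , 81)
  ∷ (57 , 324)
  ∷ (53 , 1296)
  ∷ (51 , 648)
  ∷ (49 , 648)
  ∷ (47 , 3888)
  ∷ (45 , 6732)
  ∷ (43 , 7776)
  ∷ (41 , 9234)
  ∷ (39 , 14472)
  ∷ (37 , 12636)
  ∷ (35 , 5184)
  ∷ (33 , 1944)
  ∷ (31 , 648)
  ∷ (27 , 24)
  ∷ []

lookupSize : ℕ → List (ℕ × ℕ) → ℕ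
lookupSize k [] = 0
lookupSize k ((a , b) ∷ t) = if k ≡ᵇ a then b else lookupSize k t

sizeCount : ℕ → ℕ
sizeCount k = lookupSize k sizeTable

-- A point set is a geometric hyperplane exactly when it is proper and meets every line in an odd
-- number of points, i.e. its indicator b satisfies b(x₂) = xnor (b(x₀), b(x₁)) along every line.
-- Such odd labellings of PG(1,2)ⁿ are in bijection with arbitrary labellings of the subcube {0,1}ⁿ:
-- the value at a point with a coordinate 2 is forced by the xnor rule, and the forced extension is
-- odd on every line because xnor satisfies the interchange law. So there are 2¹⁶ odd sets in S(4),
-- all but the full one proper. Counting incident point-line pairs twice, with four lines through
-- every point and one or three points of H on every line, gives 4|H| = 108 + 2|L(H)|. The size
-- distribution is computed over the 65535 labellings of {0,1}⁴; a hyperplane of size 27 then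
-- contains no line, so it is an ovoid, and an ovoid meets every line exactly once.

module Submission where

open import Defs
open import Data.Nat using (ℕ; _+_; _*_)
open import Data.Fin.Subset using (∣_∣)
open import Data.Product using (_×_)
open import Relation.Binary.PropositionalEquality using (_≡_)

open import Algebra.Bundles using (CommutativeRing)
open import Data.Bool using (Bool; true; false; not; _∧_; _xor_; T)
open import Data.Bool.Properties using (xor-annihilates-not; xor-∧-commutativeRing; T?)
import Data.Bool.Properties as Bool
open import Data.Empty using (⊥-elim)
open import Data.Fin using (Fin; zero; suc; #_; toℕ; combine; remQuot; fromℕ<)
open import Data.Fin.Properties using (combine-remQuot; combine-injective; toℕ-fromℕ<)
import Data.Fin.Properties as Fin
open import Data.Fin.Subset using (Subset; ⊤)
open import Data.Fin.Subset.Properties using (∣p∣≤n)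
open import Data.List using (List; []; _∷_; map; filter; length; foldr; cartesianProduct; cartesianProductWith; allFin; _++_)
import Data.List as List
open import Data.List.Properties using (map-++; map-∘; map-cong; length-map; map-tabulate; filter-none; filter-all; filter-accept; filter-reject)
open import Data.List.Membership.Propositional using (_∈_; _∉_)
open import Data.List.Membership.Propositional.Properties using (∈-map⁺; ∈-map⁻; ∈-filter⁺; ∈-filter⁻; ∈-cartesianProduct⁺; ∈-cartesianProductWith⁺; ∈-allFin)
open import Data.List.Membership.Propositional.Properties.WithK using (unique∧set⇒bag)
open import Data.List.Relation.Binary.BagAndSetEquality using (∼bag⇒↭)
open import Data.List.Relation.Binary.Permutation.Propositional using (_↭_)
open import Data.List.Relation.Binary.Permutation.Propositional.Properties using (↭-length)
import Data.List.Relation.Binary.Permutation.Propositional.Properties as ↭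
open import Data.List.Relation.Unary.Any using (here; there)
open import Data.List.Relation.Unary.All as All using (All)
open import Data.List.Relation.Unary.AllPairs using ([]; _∷_)
open import Data.List.Relation.Unary.Unique.Propositional using (Unique)
import Data.List.Relation.Unary.Unique.Propositional.Properties as Unique
open import Data.Nat using (zero; suc; s≤s; _≤_; _<?_; _≟_; _∸_)
import Data.Nat.Properties as ℕ
open import Data.Nat.ListAction using (sum)
open import Data.Nat.ListAction.Properties using (sum-++; sum-↭)
open import Data.Nat.Solver using (module +-*-Solver)
open import Data.Product using (∃-syntax; _,_; proj₁; proj₂)
open import Data.Product.Properties using (≡-dec)
open import Data.Sum using (_⊎_; inj₁; inj₂)
open import Data.Vec using (Vec; []; _∷_; lookup; tabulate; insertAt; removeAt; replicate)
open import Data.Vec.Properties using (lookup∘tabulate; tabulate∘lookup; tabulate-cong; []=⇒lookup; lookup⇒[]=; insertAt-lookup; removeAt-insertAt; insertAt-removeAt; lookup-replicate; ∷-injective)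
open import Function using (_∘_; id)
open import Function.Bundles using (_⇔_; mk⇔; Equivalence)
import Function.Properties.Equivalence as ⇔
open import Relation.Binary.Definitions using (DecidableEquality)
open import Relation.Binary.PropositionalEquality using (refl; sym; trans; cong; cong₂; subst; _≢_; module ≡-Reasoning)
open import Relation.Nullary using (¬_; ¬?; yes; no)
open import Relation.Nullary.Decidable using (decidable-stable)
open import Relation.Unary using (Decidable; U)
open import Relation.Unary.Properties using (U?)

open Equivalence using (to; from)

private
  variable
    A B : Set

xnor : Bool → Bool → Bool
xnor a b = not (a xor b)

xnor-interchange : ∀ a b c d → xnor (xnor a b) (xnor c d) ≡ xnor (xnor a c) (xnor b d)
xnor-interchange a b c d = cong not (begin
  not (a xor b) xor not (c xor d) ≡⟨ xor-annihilates-not (a xor b) (c xor d) ⟩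
  (a xor b) xor (c xor d)         ≡⟨ interchange a b c d ⟩
  (a xor c) xor (b xor d)         ≡⟨ xor-annihilates-not (a xor c) (b xor d) ⟨
  not (a xor c) xor not (b xor d) ∎)
  where
  open ≡-Reasoning
  open import Algebra.Properties.CommutativeSemigroup
    (CommutativeRing.+-commutativeSemigroup xor-∧-commutativeRing) using (interchange)

T-∧₃ : ∀ a b c → T (a ∧ b ∧ c) ⇔ (a ≡ true × b ≡ true × c ≡ true)
T-∧₃ a b c = mk⇔ (to′ a b c) from′
  where
  to′ : ∀ a b c → T (a ∧ b ∧ c) → a ≡ true × b ≡ true × c ≡ true
  to′ true true true _ = refl , refl , refl
  from′ : ∀ {a b c} → a ≡ true × b ≡ true × c ≡ true → T (a ∧ b ∧ c)
  from′ (refl , refl , refl) = _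

-- b takes the value true at an odd number of the three points of PG(1,2).
Odd : (Fin 3 → Bool) → Set
Odd b = b (# 2) ≡ xnor (b (# 0)) (b (# 1))

Odd-cong : ∀ {b c : Fin 3 → Bool} → (∀ x → b x ≡ c x) → Odd b → Odd c
Odd-cong b≗c odd = trans (sym (b≗c (# 2))) (trans odd (cong₂ xnor (b≗c (# 0)) (b≗c (# 1))))

AllOrOne : (Fin 3 → Set) → Set
AllOrOne P = (∀ x → P x) ⊎ ∃[ x ] (P x × ∀ y → P y → y ≡ x)

AllOrOne-cong : ∀ {P Q : Fin 3 → Set} → (∀ x → P x ⇔ Q x) → AllOrOne P → AllOrOne Q
AllOrOne-cong P⇔Q (inj₁ all) = inj₁ λ x → to (P⇔Q x) (all x)
AllOrOne-cong P⇔Q (inj₂ (x , px , unique)) =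
  inj₂ (x , to (P⇔Q x) px , λ y qy → unique y (from (P⇔Q y) qy))

¬AllOrOne-none : ∀ {P : Fin 3 → Set} → (∀ x → ¬ P x) → ¬ AllOrOne P
¬AllOrOne-none ¬p (inj₁ all)          = ¬p zero (all zero)
¬AllOrOne-none ¬p (inj₂ (x , px , _)) = ¬p x px

¬AllOrOne-two : ∀ {P : Fin 3 → Set} {x y z} → x ≢ y → P x → P y → ¬ P z → ¬ AllOrOne P
¬AllOrOne-two x≢y px py ¬pz (inj₁ all)              = ¬pz (all _)
¬AllOrOne-two x≢y px py ¬pz (inj₂ (_ , _ , unique)) = x≢y (trans (unique _ px) (sym (unique _ py)))

odd⇒AllOrOne : ∀ a b → AllOrOne (λ x → lookup (a ∷ b ∷ xnor a b ∷ []) x ≡ true)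
odd⇒AllOrOne true  true  = inj₁ λ { zero → refl ; (suc zero) → refl ; (suc (suc zero)) → refl }
odd⇒AllOrOne true  false = inj₂ (# 0 , refl , λ { zero _ → refl ; (suc zero) () ; (suc (suc zero)) () })
odd⇒AllOrOne false true  = inj₂ (# 1 , refl , λ { zero () ; (suc zero) _ → refl ; (suc (suc zero)) () })
odd⇒AllOrOne false false = inj₂ (# 2 , refl , λ { zero () ; (suc zero) () ; (suc (suc zero)) _ → refl })

AllOrOne⇒odd : ∀ a b c → AllOrOne (λ x → lookup (a ∷ b ∷ c ∷ []) x ≡ true) → c ≡ xnor a b
AllOrOne⇒odd true  true  true  _ = refl
AllOrOne⇒odd true  false false _ = refl
AllOrOne⇒odd false true  false _ = refl
AllOrOne⇒odd false false true  _ = refl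
AllOrOne⇒odd true  true  false h = ⊥-elim (¬AllOrOne-two {x = # 0} {# 1} {# 2} (λ ()) refl refl (λ ()) h)
AllOrOne⇒odd true  false true  h = ⊥-elim (¬AllOrOne-two {x = # 0} {# 2} {# 1} (λ ()) refl refl (λ ()) h)
AllOrOne⇒odd false true  true  h = ⊥-elim (¬AllOrOne-two {x = # 1} {# 2} {# 0} (λ ()) refl refl (λ ()) h)
AllOrOne⇒odd false false false h =
  ⊥-elim (¬AllOrOne-none (λ { zero () ; (suc zero) () ; (suc (suc zero)) () }) h)

-- Odd labellings of PG(1,2)ⁿ

-- Cube n tabulates a Boolean function on {0,1}ⁿ ⊆ PG(1,2)ⁿ as a complete binary tree.
Cube : ℕ → Set
Cube zero    = Bool
Cube (suc n) = Cube n × Cube n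

full : ∀ {n} → Cube n
full {zero}  = true
full {suc n} = full , full

_≟ᶜ_ : ∀ {n} → DecidableEquality (Cube n)
_≟ᶜ_ {zero}  = Bool._≟_
_≟ᶜ_ {suc n} = ≡-dec _≟ᶜ_ _≟ᶜ_

extend₁ : Bool → Bool → Fin 3 → Bool
extend₁ a b zero             = a
extend₁ a b (suc zero)       = b
extend₁ a b (suc (suc zero)) = xnor a b

extend : ∀ {n} → Cube n → Vec (Fin 3) n → Bool
extend {zero}  c        []      = c
extend {suc n} (c₀ , c₁) (x ∷ p) = extend₁ (extend c₀ p) (extend c₁ p) x

restrict : ∀ {n} → (Vec (Fin 3) n → Bool) → Cube n
restrict {zero}  g = g []
restrict {suc n} g = restrict (λ p → g (zero ∷ p)) , restrict (λ p → g (suc zero ∷ p))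

OddOnLines : ∀ {n} → (Vec (Fin 3) (suc n) → Bool) → Set
OddOnLines g = ∀ i w → Odd (λ x → g (insertAt w i x))

extend₁-odd : ∀ (b : Fin 3 → Bool) → Odd b → ∀ x → extend₁ (b (# 0)) (b (# 1)) x ≡ b x
extend₁-odd b odd zero             = refl
extend₁-odd b odd (suc zero)       = refl
extend₁-odd b odd (suc (suc zero)) = sym odd

extend₁-xnor : ∀ x a₀ a₁ b₀ b₁ →
               extend₁ (xnor a₀ a₁) (xnor b₀ b₁) x ≡ xnor (extend₁ a₀ b₀ x) (extend₁ a₁ b₁ x)
extend₁-xnor zero             a₀ a₁ b₀ b₁ = refl
extend₁-xnor (suc zero)       a₀ a₁ b₀ b₁ = refl
extend₁-xnor (suc (suc zero)) a₀ a₁ b₀ b₁ = xnor-interchange a₀ a₁ b₀ b₁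

extend-odd : ∀ {n} (c : Cube (suc n)) → OddOnLines (extend c)
extend-odd c zero w = refl
extend-odd {suc n} (c₀ , c₁) (suc i) (y ∷ w) =
  trans (cong₂ (λ a b → extend₁ a b y) (extend-odd c₀ i w) (extend-odd c₁ i w))
        (extend₁-xnor y _ _ _ _)

restrict-cong : ∀ {n} {g h : Vec (Fin 3) n → Bool} → (∀ p → g p ≡ h p) → restrict g ≡ restrict h
restrict-cong {zero}  g≗h = g≗h []
restrict-cong {suc n} g≗h = cong₂ _,_ (restrict-cong (g≗h ∘ (zero ∷_))) (restrict-cong (g≗h ∘ (suc zero ∷_)))

restrict-extend : ∀ {n} (c : Cube n) → restrict (extend c) ≡ c
restrict-extend {zero}  c         = refl
restrict-extend {suc n} (c₀ , c₁) = cong₂ _,_ (restrict-extend c₀) (restrict-extend c₁)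

extend-restrict : ∀ {n} (g : Vec (Fin 3) (suc n) → Bool) → OddOnLines g → ∀ p → extend (restrict g) p ≡ g p
extend-restrict g odd (x ∷ []) = extend₁-odd (λ y → g (y ∷ [])) (odd zero []) x
extend-restrict g odd (x ∷ p@(_ ∷ _)) =
  trans (cong₂ (λ a b → extend₁ a b x) (slice zero) (slice (suc zero)))
        (extend₁-odd (λ y → g (y ∷ p)) (odd zero p) x)
  where
  slice : ∀ y → extend (restrict (λ q → g (y ∷ q))) p ≡ g (y ∷ p)
  slice y = extend-restrict (λ q → g (y ∷ q)) (λ i w → odd (suc i) (y ∷ w)) p

decode : Fin 81 → Point
decode i =
  let (a , j) = remQuot {3} 27 i
      (b , k) = remQuot {3} 9 j
      (c , d) = remQuot {3} 3 k
  in a ∷ b ∷ c ∷ d ∷ []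

idx-decode : ∀ i → idx (decode i) ≡ i
idx-decode i = begin
  combine a (combine b (combine c d)) ≡⟨ cong (combine a ∘ combine b) (combine-remQuot {3} 3 k) ⟩
  combine a (combine b k)             ≡⟨ cong (combine a) (combine-remQuot {3} 9 j) ⟩
  combine a j                         ≡⟨ combine-remQuot {3} 27 i ⟩
  i                                   ∎
  where
  open ≡-Reasoning
  a = proj₁ (remQuot {3} 27 i)
  j = proj₂ (remQuot {3} 27 i)
  b = proj₁ (remQuot {3} 9 j)
  k = proj₂ (remQuot {3} 9 j)
  c = proj₁ (remQuot {3} 3 k)
  d = proj₂ (remQuot {3} 3 k)

idx-injective : ∀ {p q} → idx p ≡ idx q → p ≡ q
idx-injective {a ∷ b ∷ c ∷ d ∷ []} {a′ ∷ b′ ∷ c′ ∷ d′ ∷ []} eq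
  with refl , eq′ ← combine-injective a _ a′ _ eq
  with refl , eq″ ← combine-injective b _ b′ _ eq′
  with refl , refl ← combine-injective c d c′ d′ eq″
  = refl

decode-idx : ∀ p → decode (idx p) ≡ p
decode-idx p = idx-injective (idx-decode (idx p))

member : PointSet → Point → Bool
member H p = lookup H (idx p)

∈ₚ⇔member : ∀ {H} p → p ∈ₚ H ⇔ member H p ≡ true
∈ₚ⇔member {H} p = mk⇔ []=⇒lookup (lookup⇒[]= (idx p) H)

toSet : (Point → Bool) → PointSet
toSet g = tabulate (g ∘ decode)

member-toSet : ∀ g p → member (toSet g) p ≡ g p
member-toSet g p = trans (lookup∘tabulate (g ∘ decode) (idx p)) (cong g (decode-idx p))

toSet-member : ∀ H → toSet (member H) ≡ H
toSet-member H = trans (tabulate-cong (cong (lookup H) ∘ idx-decode)) (tabulate∘lookup H)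

toSet-cong : ∀ {g h} → (∀ p → g p ≡ h p) → toSet g ≡ toSet h
toSet-cong g≗h = tabulate-cong (g≗h ∘ decode)

line⇔odd : ∀ H l → (LineIn H l ⊎ MeetsOnce H l) ⇔ Odd (λ x → member H (pt l x))
line⇔odd H l = mk⇔
  (λ h → AllOrOne⇒odd (b (# 0)) (b (# 1)) (b (# 2)) (AllOrOne-cong onLine h))
  (λ odd → AllOrOne-cong (⇔.sym ∘ onLine)
             (subst (λ c → AllOrOne (λ x → lookup (b (# 0) ∷ b (# 1) ∷ c ∷ []) x ≡ true))
                    (sym odd) (odd⇒AllOrOne (b (# 0)) (b (# 1)))))
  where
  b : Fin 3 → Bool
  b x = member H (pt l x)
  onLine : ∀ x → pt l x ∈ₚ H ⇔ lookup (b (# 0) ∷ b (# 1) ∷ b (# 2) ∷ []) x ≡ true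
  onLine zero             = ∈ₚ⇔member (pt l zero)
  onLine (suc zero)       = ∈ₚ⇔member (pt l (suc zero))
  onLine (suc (suc zero)) = ∈ₚ⇔member (pt l (suc (suc zero)))

hyperplane⇒odd : ∀ {H} → IsGeomHyperplane H → OddOnLines (member H)
hyperplane⇒odd {H} (_ , meets) i w = to (line⇔odd H (i , w)) (meets (i , w))

-- Hyperplanes as odd sets

oddSet : Cube 4 → PointSet
oddSet c = toSet (extend c)

oddSet-full : oddSet full ≡ ⊤
oddSet-full = refl

oddSet-odd : ∀ c → OddOnLines (member (oddSet c))
oddSet-odd c i w = Odd-cong (λ x → sym (member-toSet (extend c) (insertAt w i x))) (extend-odd c i w)

restrict-oddSet : ∀ c → restrict (member (oddSet c)) ≡ c
restrict-oddSet c = trans (restrict-cong (member-toSet (extend c))) (restrict-extend c)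

oddSet-restrict : ∀ {H} → OddOnLines (member H) → oddSet (restrict (member H)) ≡ H
oddSet-restrict {H} odd = trans (toSet-cong (extend-restrict (member H) odd)) (toSet-member H)

oddSet-injective : ∀ {c d} → oddSet c ≡ oddSet d → c ≡ d
oddSet-injective {c} {d} eq =
  trans (sym (restrict-oddSet c)) (trans (cong (restrict ∘ member) eq) (restrict-oddSet d))

oddSet-hyperplane : ∀ {c} → c ≢ full → IsGeomHyperplane (oddSet c)
oddSet-hyperplane {c} c≢full =
  (λ c⊤ → c≢full (oddSet-injective (trans c⊤ (sym oddSet-full)))) ,
  λ (i , w) → from (line⇔odd (oddSet c) (i , w)) (oddSet-odd c i w)

hyperplane-restrict≢full : ∀ {H} → IsGeomHyperplane H → restrict (member H) ≢ full
hyperplane-restrict≢full {H} hyp@(H≢⊤ , _) eq =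
  H≢⊤ (trans (sym (oddSet-restrict (hyperplane⇒odd hyp))) (trans (cong oddSet eq) oddSet-full))

vectors : List A → ∀ n → List (Vec A n)
vectors xs zero    = [] ∷ []
vectors xs (suc n) = cartesianProductWith _∷_ xs (vectors xs n)

vectors-unique : ∀ {xs : List A} → Unique xs → ∀ n → Unique (vectors xs n)
vectors-unique xs! zero    = All.[] ∷ []
vectors-unique xs! (suc n) = Unique.cartesianProductWith⁺ _∷_ ∷-injective xs! (vectors-unique xs! n)

∈-vectors : ∀ {xs : List A} → (∀ x → x ∈ xs) → ∀ {n} (v : Vec A n) → v ∈ vectors xs n
∈-vectors ∈xs []      = here refl
∈-vectors ∈xs (x ∷ v) = ∈-cartesianProductWith⁺ _∷_ (∈xs x) (∈-vectors ∈xs v)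

cubes : ∀ n → List (Cube n)
cubes zero    = true ∷ false ∷ []
cubes (suc n) = cartesianProduct (cubes n) (cubes n)

cubes-unique : ∀ n → Unique (cubes n)
cubes-unique zero    = ((λ ()) All.∷ All.[]) ∷ (All.[] ∷ [])
cubes-unique (suc n) = Unique.cartesianProduct⁺ (cubes-unique n) (cubes-unique n)

∈-cubes : ∀ {n} (c : Cube n) → c ∈ cubes n
∈-cubes {zero}  true      = here refl
∈-cubes {zero}  false     = there (here refl)
∈-cubes {suc n} (c₀ , c₁) = ∈-cartesianProduct⁺ (∈-cubes c₀) (∈-cubes c₁)

allPoints : List Point
allPoints = vectors (allFin 3) 4

allOffsets : List (Vec (Fin 3) 3)
allOffsets = vectors (allFin 3) 3

allLines : List Line
allLines = cartesianProduct (allFin 4) allOffsets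

allLines-unique : Unique allLines
allLines-unique = Unique.cartesianProduct⁺ (Unique.allFin⁺ 4) (vectors-unique (Unique.allFin⁺ 3) 3)

∈-allLines : ∀ l → l ∈ allLines
∈-allLines (i , w) = ∈-cartesianProduct⁺ (∈-allFin i) (∈-vectors ∈-allFin w)

≢full? : ∀ {n} → Decidable (_≢ full {n})
≢full? c = ¬? (c ≟ᶜ full)

unique∧set⇒↭ : ∀ {xs ys : List A} → Unique xs → Unique ys → (∀ z → z ∈ xs ⇔ z ∈ ys) → xs ↭ ys
unique∧set⇒↭ xs! ys! xs⇔ys = ∼bag⇒↭ (unique∧set⇒bag xs! ys! λ {z} → xs⇔ys z)

HasCount-unique : ∀ {P : A → Set} {m n} → HasCount P m → HasCount P n → m ≡ n
HasCount-unique (xs , xs! , ∈xs⇔P , refl) (ys , ys! , ∈ys⇔P , refl) =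
  ↭-length (unique∧set⇒↭ xs! ys! λ z → ⇔.trans (∈xs⇔P z) (⇔.sym (∈ys⇔P z)))

HasCount-cong : ∀ {P Q : A → Set} {n} → (∀ x → P x ⇔ Q x) → HasCount P n → HasCount Q n
HasCount-cong P⇔Q (xs , xs! , ∈xs⇔P , len) = xs , xs! , (λ x → ⇔.trans (∈xs⇔P x) (P⇔Q x)) , len

-- Double counting of flags

𝟙 : Bool → ℕ
𝟙 true  = 1
𝟙 false = 0

sum-cartesianProductWith : ∀ {C : Set} (f : C → ℕ) (g : A → B → C) xs ys →
  sum (map f (cartesianProductWith g xs ys)) ≡ sum (map (λ x → sum (map (λ y → f (g x y)) ys)) xs)
sum-cartesianProductWith f g []       ys = refl
sum-cartesianProductWith f g (x ∷ xs) ys = begin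
  sum (map f (map (g x) ys ++ cartesianProductWith g xs ys))
    ≡⟨ cong sum (map-++ f (map (g x) ys) _) ⟩
  sum (map f (map (g x) ys) ++ map f (cartesianProductWith g xs ys))
    ≡⟨ sum-++ (map f (map (g x) ys)) _ ⟩
  sum (map f (map (g x) ys)) + sum (map f (cartesianProductWith g xs ys))
    ≡⟨ cong₂ _+_ (sym (cong sum (map-∘ ys))) (sum-cartesianProductWith f g xs ys) ⟩
  sum (map (λ y → f (g x y)) ys) + sum (map (λ x → sum (map (λ y → f (g x y)) ys)) xs) ∎
  where open ≡-Reasoning

insertAt-injective : ∀ {n} {v w : Vec A n} i {x y} → insertAt v i x ≡ insertAt w i y → v ≡ w × x ≡ y
insertAt-injective {v = v} {w} i {x} {y} eq =
  trans (sym (removeAt-insertAt v i x)) (trans (cong (λ u → removeAt u i) eq) (removeAt-insertAt w i y)) ,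
  trans (sym (insertAt-lookup v i x)) (trans (cong (λ u → lookup u i) eq) (insertAt-lookup w i y))

pt-injective : ∀ l {x y} → pt l x ≡ pt l y → x ≡ y
pt-injective (i , w) = proj₂ ∘ insertAt-injective i

pointsAlong : Fin 4 → List Point
pointsAlong i = map (λ (w , x) → insertAt w i x) (cartesianProduct allOffsets (allFin 3))

pointsAlong↭allPoints : ∀ i → pointsAlong i ↭ allPoints
pointsAlong↭allPoints i = unique∧set⇒↭
  (Unique.map⁺ {f = λ (w , x) → insertAt w i x} (λ eq → let (w≡ , x≡) = insertAt-injective i eq in cong₂ _,_ w≡ x≡)
               {cartesianProduct allOffsets (allFin 3)}
               (Unique.cartesianProduct⁺ (vectors-unique (Unique.allFin⁺ 3) 3) (Unique.allFin⁺ 3)))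
  (vectors-unique (Unique.allFin⁺ 3) 4)
  (λ p → mk⇔ (λ _ → ∈-vectors ∈-allFin p) (λ _ → along p))
  where
  along : ∀ p → p ∈ pointsAlong i
  along p = subst (_∈ pointsAlong i) (insertAt-removeAt p i)
    (∈-map⁺ (λ (w , x) → insertAt w i x)
            (∈-cartesianProduct⁺ (∈-vectors ∈-allFin (removeAt p i)) (∈-allFin (lookup p i))))

sumOn : (Point → ℕ) → Line → ℕ
sumOn f l = sum (map (f ∘ pt l) (allFin 3))

sum-flags≡4*sum-points : ∀ (f : Point → ℕ) → sum (map (sumOn f) allLines) ≡ 4 * sum (map f allPoints)
sum-flags≡4*sum-points f =
  trans (sum-cartesianProductWith (sumOn f) _,_ (allFin 4) allOffsets) (cong sum (map-cong along (allFin 4)))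
  where
  along : ∀ i → sum (map (λ w → sumOn f (i , w)) allOffsets) ≡ sum (map f allPoints)
  along i = begin
    sum (map (λ w → sumOn f (i , w)) allOffsets)
      ≡⟨ sum-cartesianProductWith (λ (w , x) → f (insertAt w i x)) _,_ allOffsets (allFin 3) ⟨
    sum (map (λ (w , x) → f (insertAt w i x)) (cartesianProduct allOffsets (allFin 3)))
      ≡⟨ cong sum (map-∘ {g = f} {f = λ (w , x) → insertAt w i x} (cartesianProduct allOffsets (allFin 3))) ⟩
    sum (map f (pointsAlong i))
      ≡⟨ sum-↭ (↭.map⁺ f (pointsAlong↭allPoints i)) ⟩
    sum (map f allPoints) ∎
    where open ≡-Reasoning

∣p∣≡sum : ∀ {n} (H : Subset n) → ∣ H ∣ ≡ sum (List.tabulate (𝟙 ∘ lookup H))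
∣p∣≡sum []          = refl
∣p∣≡sum (true  ∷ H) = cong suc (∣p∣≡sum H)
∣p∣≡sum (false ∷ H) = ∣p∣≡sum H

∣H∣≡sum-points : ∀ H → ∣ H ∣ ≡ sum (map (𝟙 ∘ member H) allPoints)
∣H∣≡sum-points H = begin
  ∣ H ∣                                                ≡⟨ ∣p∣≡sum H ⟩
  sum (List.tabulate (𝟙 ∘ lookup H))                   ≡⟨ cong sum (map-tabulate id (𝟙 ∘ lookup H)) ⟨
  sum (map (𝟙 ∘ lookup H) (allFin 81))                 ≡⟨⟩
  sum (map (𝟙 ∘ lookup H) (map idx allPoints))         ≡⟨ cong sum (map-∘ {g = 𝟙 ∘ lookup H} {f = idx} allPoints) ⟨
  sum (map (𝟙 ∘ member H) allPoints)                   ∎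
  where open ≡-Reasoning

lineInᵇ : PointSet → Line → Bool
lineInᵇ H l = member H (pt l (# 0)) ∧ member H (pt l (# 1)) ∧ member H (pt l (# 2))

linesIn : PointSet → List Line
linesIn H = filter (T? ∘ lineInᵇ H) allLines

LineIn⇔lineInᵇ : ∀ H l → LineIn H l ⇔ T (lineInᵇ H l)
LineIn⇔lineInᵇ H l = mk⇔
  (λ inH → from (T-∧₃ (b (# 0)) (b (# 1)) (b (# 2))) (member-of (# 0) inH , member-of (# 1) inH , member-of (# 2) inH))
  (λ t → let (b₀ , b₁ , b₂) = to (T-∧₃ (b (# 0)) (b (# 1)) (b (# 2))) t in
     λ { zero             → from (∈ₚ⇔member {H} (pt l zero)) b₀
       ; (suc zero)       → from (∈ₚ⇔member {H} (pt l (suc zero))) b₁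
       ; (suc (suc zero)) → from (∈ₚ⇔member {H} (pt l (suc (suc zero)))) b₂ })
  where
  b : Fin 3 → Bool
  b x = member H (pt l x)
  member-of : ∀ x → LineIn H l → b x ≡ true
  member-of x inH = to (∈ₚ⇔member {H} (pt l x)) (inH x)

linesIn-count : ∀ H → HasCount (LineIn H) (length (linesIn H))
linesIn-count H =
  linesIn H ,
  Unique.filter⁺ (T? ∘ lineInᵇ H) allLines-unique ,
  (λ l → mk⇔ (from (LineIn⇔lineInᵇ H l) ∘ proj₂ ∘ ∈-filter⁻ (T? ∘ lineInᵇ H))
             (∈-filter⁺ (T? ∘ lineInᵇ H) (∈-allLines l) ∘ to (LineIn⇔lineInᵇ H l))) ,
  refl

flags-on-odd-line : ∀ a b c → c ≡ xnor a b → 𝟙 a + (𝟙 b + (𝟙 c + 0)) ≡ suc (2 * 𝟙 (a ∧ b ∧ c))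
flags-on-odd-line true  true  _ refl = refl
flags-on-odd-line true  false _ refl = refl
flags-on-odd-line false true  _ refl = refl
flags-on-odd-line false false _ refl = refl

sum-map-1+2* : ∀ (f : A → ℕ) xs → sum (map (λ x → suc (2 * f x)) xs) ≡ length xs + 2 * sum (map f xs)
sum-map-1+2* f []       = refl
sum-map-1+2* f (x ∷ xs) = trans (cong (suc (2 * f x) +_) (sum-map-1+2* f xs)) (lemma (f x) (length xs) (sum (map f xs)))
  where
  open +-*-Solver
  lemma : ∀ a l s → suc (2 * a) + (l + 2 * s) ≡ suc l + 2 * (a + s)
  lemma = solve 3 (λ a l s → con 1 :+ con 2 :* a :+ (l :+ con 2 :* s) := con 1 :+ l :+ con 2 :* (a :+ s)) refl

length-filter-T : ∀ (f : A → Bool) xs → length (filter (T? ∘ f) xs) ≡ sum (map (𝟙 ∘ f) xs)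
length-filter-T f []       = refl
length-filter-T f (x ∷ xs) with f x
... | true  = cong suc (length-filter-T f xs)
... | false = length-filter-T f xs

length-linesIn+54≡2*∣H∣ : ∀ {H} → IsGeomHyperplane H → length (linesIn H) + 54 ≡ 2 * ∣ H ∣
length-linesIn+54≡2*∣H∣ {H} hyp = ℕ.*-cancelˡ-≡ _ _ 2 (begin
  2 * (L + 54)                                                  ≡⟨ cong (2 *_) (ℕ.+-comm L 54) ⟩
  2 * (54 + L)                                                  ≡⟨ ℕ.*-distribˡ-+ 2 54 L ⟩
  108 + 2 * L                                                   ≡⟨ cong (λ n → 108 + 2 * n) (length-filter-T (lineInᵇ H) allLines) ⟩
  length allLines + 2 * sum (map (𝟙 ∘ lineInᵇ H) allLines)      ≡⟨ sum-map-1+2* (𝟙 ∘ lineInᵇ H) allLines ⟨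
  sum (map (λ l → suc (2 * 𝟙 (lineInᵇ H l))) allLines)          ≡⟨ cong sum (map-cong flags allLines) ⟨
  sum (map (sumOn (𝟙 ∘ member H)) allLines)                     ≡⟨ sum-flags≡4*sum-points (𝟙 ∘ member H) ⟩
  4 * sum (map (𝟙 ∘ member H) allPoints)                        ≡⟨ cong (4 *_) (∣H∣≡sum-points H) ⟨
  4 * ∣ H ∣                                                     ≡⟨ ℕ.*-assoc 2 2 ∣ H ∣ ⟩
  2 * (2 * ∣ H ∣)                                               ∎)
  where
  open ≡-Reasoning
  L = length (linesIn H)
  flags : ∀ l → sumOn (𝟙 ∘ member H) l ≡ suc (2 * 𝟙 (lineInᵇ H l))
  flags (i , w) = flags-on-odd-line (b (# 0)) (b (# 1)) (b (# 2)) (hyperplane⇒odd {H} hyp i w)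
    where
    b : Fin 3 → Bool
    b x = member H (insertAt w i x)

-- The size distribution

xnorᶜ : ∀ {n} → Cube n → Cube n → Cube n
xnorᶜ {zero}  a         b         = xnor a b
xnorᶜ {suc n} (a₀ , a₁) (b₀ , b₁) = xnorᶜ a₀ b₀ , xnorᶜ a₁ b₁

extend-xnorᶜ : ∀ {n} (a b : Cube n) p → extend (xnorᶜ a b) p ≡ xnor (extend a p) (extend b p)
extend-xnorᶜ {zero}  a         b         []      = refl
extend-xnorᶜ {suc n} (a₀ , a₁) (b₀ , b₁) (x ∷ p) =
  trans (cong₂ (λ u v → extend₁ u v x) (extend-xnorᶜ a₀ b₀ p) (extend-xnorᶜ a₁ b₁ p))
        (extend₁-xnor x (extend a₀ p) (extend b₀ p) (extend a₁ p) (extend b₁ p))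

-- The slice x₁ = 2 of extend (c₀ , c₁) is extend (xnorᶜ c₀ c₁), so this recursion counts the points
-- labelled true (weight≡sum) far more cheaply than the sum over all points; weight-tally evaluates it
-- for every cube.
weight : ∀ {n} → Cube n → ℕ
weight {zero}  c         = 𝟙 c
weight {suc n} (c₀ , c₁) = weight c₀ + weight c₁ + weight (xnorᶜ c₀ c₁)

weight≡sum : ∀ {n} (c : Cube n) → weight c ≡ sum (map (𝟙 ∘ extend c) (vectors (allFin 3) n))
weight≡sum {zero}  c         = sym (ℕ.+-identityʳ (𝟙 c))
weight≡sum {suc n} (c₀ , c₁) = begin
  weight c₀ + weight c₁ + weight (xnorᶜ c₀ c₁)
    ≡⟨ ℕ.+-assoc (weight c₀) _ _ ⟩
  weight c₀ + (weight c₁ + weight (xnorᶜ c₀ c₁))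
    ≡⟨ cong (λ s → weight c₀ + (weight c₁ + s)) (ℕ.+-identityʳ _) ⟨
  weight c₀ + (weight c₁ + (weight (xnorᶜ c₀ c₁) + 0))
    ≡⟨ cong₂ _+_ (weight≡sum c₀) (cong₂ _+_ (weight≡sum c₁) (cong (_+ 0) (trans (weight≡sum (xnorᶜ c₀ c₁))
         (cong sum (map-cong (cong 𝟙 ∘ extend-xnorᶜ c₀ c₁) V))))) ⟩
  sum (map (λ x → sum (map (λ p → 𝟙 (extend (c₀ , c₁) (x ∷ p))) V)) (allFin 3))
    ≡⟨ sum-cartesianProductWith (𝟙 ∘ extend (c₀ , c₁)) _∷_ (allFin 3) V ⟨
  sum (map (𝟙 ∘ extend (c₀ , c₁)) (vectors (allFin 3) (suc n))) ∎
  where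
  open ≡-Reasoning
  V = vectors (allFin 3) n

∣oddSet∣≡weight : ∀ c → ∣ oddSet c ∣ ≡ weight c
∣oddSet∣≡weight c = begin
  ∣ oddSet c ∣                              ≡⟨ ∣H∣≡sum-points (oddSet c) ⟩
  sum (map (𝟙 ∘ member (oddSet c)) allPoints) ≡⟨ cong sum (map-cong (cong 𝟙 ∘ member-toSet (extend c)) allPoints) ⟩
  sum (map (𝟙 ∘ extend c) allPoints)        ≡⟨ weight≡sum c ⟨
  weight c                                  ∎
  where open ≡-Reasoning

increment : ∀ {n} → ℕ → Vec ℕ n → Vec ℕ n
increment k       []       = []
increment zero    (m ∷ ms) = suc m ∷ ms
increment (suc k) (m ∷ ms) = m ∷ increment k ms

lookup-increment-≡ : ∀ {n} (ms : Vec ℕ n) i → lookup (increment (toℕ i) ms) i ≡ suc (lookup ms i)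
lookup-increment-≡ (m ∷ ms) zero    = refl
lookup-increment-≡ (m ∷ ms) (suc i) = lookup-increment-≡ ms i

lookup-increment-≢ : ∀ {n} k (ms : Vec ℕ n) i → k ≢ toℕ i → lookup (increment k ms) i ≡ lookup ms i
lookup-increment-≢ zero    (m ∷ ms) zero    k≢i = ⊥-elim (k≢i refl)
lookup-increment-≢ (suc k) (m ∷ ms) zero    _   = refl
lookup-increment-≢ zero    (m ∷ ms) (suc i) _   = refl
lookup-increment-≢ (suc k) (m ∷ ms) (suc i) k≢i = lookup-increment-≢ k ms i (k≢i ∘ cong suc)

-- All n counts in a single pass over xs; values ≥ n are ignored.
tally : ∀ n → (A → ℕ) → List A → Vec ℕ n
tally n f = foldr (increment ∘ f) (replicate n 0)

lookup-tally : ∀ {n} (f : A → ℕ) xs (i : Fin n) →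
               lookup (tally n f xs) i ≡ length (filter (λ x → f x ≟ toℕ i) xs)
lookup-tally f []       i = lookup-replicate i 0
lookup-tally f (x ∷ xs) i with f x ≟ toℕ i
... | yes fx≡i = begin
  lookup (increment (f x) (tally _ f xs)) i    ≡⟨ cong (λ k → lookup (increment k (tally _ f xs)) i) fx≡i ⟩
  lookup (increment (toℕ i) (tally _ f xs)) i  ≡⟨ lookup-increment-≡ (tally _ f xs) i ⟩
  suc (lookup (tally _ f xs) i)                ≡⟨ cong suc (lookup-tally f xs i) ⟩
  suc (length (filter P? xs))                  ≡⟨ cong length (filter-accept P? fx≡i) ⟨
  length (filter P? (x ∷ xs))                  ∎
  where
  open ≡-Reasoning
  P? = λ y → f y ≟ toℕ i
... | no  fx≢i = begin
  lookup (increment (f x) (tally _ f xs)) i    ≡⟨ lookup-increment-≢ (f x) (tally _ f xs) i fx≢i ⟩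
  lookup (tally _ f xs) i                      ≡⟨ lookup-tally f xs i ⟩
  length (filter P? xs)                        ≡⟨ cong length (filter-reject P? fx≢i) ⟨
  length (filter P? (x ∷ xs))                  ∎
  where
  open ≡-Reasoning
  P? = λ y → f y ≟ toℕ i

weight≤81 : ∀ (c : Cube 4) → weight c ≤ 81
weight≤81 c = subst (_≤ 81) (∣oddSet∣≡weight c) (∣p∣≤n (oddSet c))

-- Ovoids

length≡0⇒∉ : ∀ {xs : List A} {x} → length xs ≡ 0 → x ∉ xs
length≡0⇒∉ {xs = []} _ ()

hyperplane27⇒¬LineIn : ∀ {H} → IsGeomHyperplane H → ∣ H ∣ ≡ 27 → ∀ l → ¬ LineIn H l
hyperplane27⇒¬LineIn {H} hyp size l inH =
  length≡0⇒∉ (ℕ.+-cancelʳ-≡ 54 (length (linesIn H)) 0 (trans (length-linesIn+54≡2*∣H∣ hyp) (cong (2 *_) size)))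
             (from (proj₁ (proj₂ (proj₂ (linesIn-count H))) l) inH)

hyperplane27⇔ovoid : ∀ H → (IsGeomHyperplane H × ∣ H ∣ ≡ 27) ⇔ IsOvoid H
hyperplane27⇔ovoid H = mk⇔ ovoid hyperplane
  where
  ovoid : IsGeomHyperplane H × ∣ H ∣ ≡ 27 → IsOvoid H
  ovoid (hyp , size) = size , nonCollinear , λ l → let (x , x∈ , _) = once l in x , x∈
    where
    once : ∀ l → MeetsOnce H l
    once l with proj₂ hyp l
    ... | inj₁ inH  = ⊥-elim (hyperplane27⇒¬LineIn hyp size l inH)
    ... | inj₂ meet = meet
    nonCollinear : ∀ p q → p ∈ₚ H → q ∈ₚ H → ¬ Collinear p q
    nonCollinear _ _ p∈ q∈ (p≢q , l , x , y , refl , refl) =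
      let (_ , _ , unique) = once l in p≢q (cong (pt l) (trans (unique x p∈) (sym (unique y q∈))))
  hyperplane : IsOvoid H → IsGeomHyperplane H × ∣ H ∣ ≡ 27
  hyperplane (size , nonCollinear , meets) = ((λ H≡⊤ → 81≢27 (trans (cong ∣_∣ (sym H≡⊤)) size)) , inj₂ ∘ once) , size
    where
    81≢27 : 81 ≢ 27
    81≢27 ()
    once : ∀ l → MeetsOnce H l
    once l = let (x , x∈) = meets l in x , x∈ , λ y y∈ → decidable-stable (y Fin.≟ x)
      λ y≢x → nonCollinear _ _ y∈ x∈ (y≢x ∘ pt-injective l , l , y , x , refl , refl)

-- The enumeration is a module parameter because Agda evaluates the concrete 65536-element list in full
-- whenever it takes part in a conversion problem; it is supplied only in mainTheorem1, together with
-- refl proofs of the two facts computed from it.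

module Census (cs : List (Cube 4)) (cs! : Unique cs) (∈cs : ∀ c → c ∈ cs)
  (nonFull-length : length (filter ≢full? cs) ≡ 65535)
  (weight-tally : tally 82 weight (filter ≢full? cs) ≡ tabulate (sizeCount ∘ toℕ)) where

  nonFull : List (Cube 4)
  nonFull = filter ≢full? cs

  hyperplanesWith : ∀ {R : PointSet → Set} {Q : Cube 4 → Set} (Q? : Decidable Q) → (∀ c → R (oddSet c) ⇔ Q c) →
                    HasCount (λ H → IsGeomHyperplane H × R H) (length (filter Q? nonFull))
  hyperplanesWith {R} {Q} Q? R⇔Q =
    map oddSet (filter Q? nonFull) ,
    Unique.map⁺ oddSet-injective (Unique.filter⁺ Q? (Unique.filter⁺ ≢full? cs!)) ,
    (λ H → mk⇔ (sound H) (complete H)) ,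
    length-map oddSet (filter Q? nonFull)
    where
    sound : ∀ H → H ∈ map oddSet (filter Q? nonFull) → IsGeomHyperplane H × R H
    sound H H∈ =
      let (c , c∈ , H≡c) = ∈-map⁻ oddSet H∈
          (c∈nonFull , Qc) = ∈-filter⁻ Q? {xs = nonFull} c∈
      in subst (λ G → IsGeomHyperplane G × R G) (sym H≡c)
               (oddSet-hyperplane (proj₂ (∈-filter⁻ ≢full? {xs = cs} c∈nonFull)) , from (R⇔Q c) Qc)
    complete : ∀ H → IsGeomHyperplane H × R H → H ∈ map oddSet (filter Q? nonFull)
    complete H (hyp , RH) = subst (_∈ map oddSet (filter Q? nonFull)) c≡H
      (∈-map⁺ oddSet (∈-filter⁺ Q? (∈-filter⁺ ≢full? (∈cs c) (hyperplane-restrict≢full {H} hyp))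
                                    (to (R⇔Q c) (subst R (sym c≡H) RH))))
      where
      c = restrict (member H)
      c≡H : oddSet c ≡ H
      c≡H = oddSet-restrict {H} (hyperplane⇒odd {H} hyp)

  hyperplanes : HasCount IsGeomHyperplane 65535
  hyperplanes = subst (HasCount IsGeomHyperplane) length≡65535
    (HasCount-cong (λ _ → mk⇔ proj₁ (_, _)) (hyperplanesWith {R = U} U? λ _ → mk⇔ id id))
    where
    length≡65535 : length (filter U? nonFull) ≡ 65535
    length≡65535 = trans (cong length (filter-all U? (All.universal _ nonFull))) nonFull-length

  Counted : ℕ → Set
  Counted k = length (filter (λ c → weight c ≟ k) nonFull) ≡ sizeCount k

  counted-below : ∀ (i : Fin 82) → Counted (toℕ i)
  counted-below i = begin
    length (filter (λ c → weight c ≟ toℕ i) nonFull) ≡⟨ lookup-tally weight nonFull i ⟨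
    lookup (tally 82 weight nonFull) i               ≡⟨ cong (λ v → lookup v i) weight-tally ⟩
    lookup (tabulate (sizeCount ∘ toℕ)) i            ≡⟨ lookup∘tabulate (sizeCount ∘ toℕ) i ⟩
    sizeCount (toℕ i)                                ∎
    where open ≡-Reasoning

  -- sizeCount (82 + j) reduces to 0.
  counted-above : ∀ j → Counted (82 + j)
  counted-above j = cong length (filter-none (λ c → weight c ≟ 82 + j) {xs = nonFull} (All.tabulate λ {c} _ → weight≢ c))
    where
    weight≢ : ∀ c → weight c ≢ 82 + j
    weight≢ c = ℕ.<⇒≢ (s≤s (ℕ.≤-trans (weight≤81 c) (ℕ.m≤m+n 81 j)))

  counted : ∀ k → Counted k
  counted k with k <? 82
  ... | yes k<82 = subst Counted (toℕ-fromℕ< k<82) (counted-below (fromℕ< k<82))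
  ... | no  k≮82 = subst Counted (ℕ.m+[n∸m]≡n (ℕ.≮⇒≥ k≮82)) (counted-above (k ∸ 82))

  hyperplanesOfSize : ∀ k → HasCount (λ H → IsGeomHyperplane H × ∣ H ∣ ≡ k) (sizeCount k)
  hyperplanesOfSize k = subst (HasCount _) (counted k)
    (hyperplanesWith (λ c → weight c ≟ k) λ c → mk⇔ (trans (sym (∣oddSet∣≡weight c))) (trans (∣oddSet∣≡weight c)))

  theorem : HasCount IsGeomHyperplane 65535
      × (∀ H → IsGeomHyperplane H
           → ∀ m → HasCount (LineIn H) m → m + 54 ≡ 2 * ∣ H ∣)
      × (∀ k → HasCount (λ H → IsGeomHyperplane H × ∣ H ∣ ≡ k) (sizeCount k))
      × HasCount IsOvoid 24
  theorem =
      hyperplanes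
    , (λ H hyp m lines → trans (cong (_+ 54) (HasCount-unique lines (linesIn-count H))) (length-linesIn+54≡2*∣H∣ hyp))
    , hyperplanesOfSize
    , HasCount-cong hyperplane27⇔ovoid (hyperplanesOfSize 27)

mainTheorem1 : HasCount IsGeomHyperplane 65535
    × (∀ H → IsGeomHyperplane H
         → ∀ m → HasCount (LineIn H) m → m + 54 ≡ 2 * ∣ H ∣)
    × (∀ k → HasCount (λ H → IsGeomHyperplane H × ∣ H ∣ ≡ k) (sizeCount k))
    × HasCount IsOvoid 24
mainTheorem1 = Census.theorem (cubes 4) (cubes-unique 4) ∈-cubes refl refl
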